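{- Let $\ell \geq 1$ and $n$ be integers. If $n \in \mathcal{D}(\ell+1,\ell) \setminus \mathcal{X}(\ell+1,\ell)$, then $\mathcal{Q}_{\ell+1}^{\ell} \,|\, \mathcal{Q}_n^{\ell}$.
   Context: $\mathcal{Q}_n$ denotes the $n$-dimensional hypercube, and $A^k$ the $k$-skeleton of a polytope $A$; $\mathcal{Q}_{\ell+1}^\ell$ is the boundary complex of the $(\ell+1)$-cube. For polytopal $\ell$-complexes $L,K$, $L\,|\,K$ means $K$ and $L$ both have dimension $\ell$ and $K$ is a union of subcomplexes $L_1,\dots,L_r$, each isomorphic to $L$, such that every $\ell$-face of $K$ lies in exactly one $L_i$. A $(v,k,t)$-configuration is a $v$-element set with a family of $k$-element subsets (blocks) such that every $t$-element subset lies in exactly one block. For $1\le t<k$, $\mathcal{D}(k,t) = \{ v \ge k : \binom{k-h}{t-h} \text{ divides } \binom{v-h}{t-h} \text{ for all } 0 \le h \le t-1\}$, and $\mathcal{X}(k,t)$ is the set of $v\in\mathcal{D}(k,t)$ for which no $(v,k,t)$-configuration exists (finite by Keevash's theorem on existence of designs, which the result uses). -}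

module Defs where

open import Data.Nat using (ℕ; zero; suc; _+_; _∸_; _≤_; _<_)
open import Data.Nat.Divisibility using (_∣_)
open import Data.Nat.Combinatorics using (_C_)
open import Data.Fin using (Fin)
open import Data.Fin.Subset using (Subset; _⊆_; ∣_∣)
open import Data.Vec using (Vec; []; _∷_)
open import Data.Product using (Σ; ∃; _×_)
open import Data.Empty using (⊥)
open import Relation.Nullary using (¬_)
open import Relation.Binary.PropositionalEquality using (_≡_)

ExactlyOne : ∀ {r} → (Fin r → Set) → Set
ExactlyOne {r} P = Σ (Fin r) λ i → P i × (∀ j → P j → j ≡ i)

record Configuration (v k t : ℕ) : Set where
  field
    r      : ℕ
    block  : Fin r → Subset v
    blockSize : ∀ i → ∣ block i ∣ ≡ k
    cover  : ∀ (T : Subset v) → ∣ T ∣ ≡ t → ExactlyOne (λ i → T ⊆ block i)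

InD : ℕ → ℕ → ℕ → Set
InD k t v = (k ≤ v) × (∀ h → h < t → ((k ∸ h) C (t ∸ h)) ∣ ((v ∸ h) C (t ∸ h)))

InX : ℕ → ℕ → ℕ → Set
InX k t v = InD k t v × ¬ Configuration v k t

-- Hypercube face lattice: faces of Q_n are words in {0,1,*}^n,
-- a face is contained in another iff it agrees with it on every
-- non-star coordinate of the larger one.

data Sym : Set where
  o i ⋆ : Sym

Face : ℕ → Set
Face n = Vec Sym n

dim : ∀ {n} → Face n → ℕ
dim [] = 0
dim (⋆ ∷ f) = suc (dim f)
dim (o ∷ f) = dim f
dim (i ∷ f) = dim f

data _≼s_ : Sym → Sym → Set where
  same : ∀ {a} → a ≼s a
  star : ∀ {a} → a ≼s ⋆

data _≼_ : ∀ {n} → Face n → Face n → Set where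
  []  : [] ≼ []
  _∷_ : ∀ {n a b} {f g : Face n} → a ≼s b → f ≼ g → (a ∷ f) ≼ (b ∷ g)

-- The ℓ-skeleton Q_n^ℓ has the (nonempty) faces f of Q_n with dim f ≤ ℓ;
-- the boundary complex Q_{ℓ+1}^ℓ is the ℓ-skeleton of Q_{ℓ+1}.
-- A Copy ℓ n is a subcomplex of Q_n^ℓ together with an isomorphism
-- of face posets from Q_{ℓ+1}^ℓ onto it.

record Copy (ℓ n : ℕ) : Set where
  field
    φ       : Face (suc ℓ) → Face n
    φ-skel  : ∀ f → dim f ≤ ℓ → dim (φ f) ≤ ℓ
    φ-inj   : ∀ f g → dim f ≤ ℓ → dim g ≤ ℓ → φ f ≡ φ g → f ≡ g
    φ-mono  : ∀ f g → dim f ≤ ℓ → dim g ≤ ℓ → f ≼ g → φ f ≼ φ g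
    φ-refl  : ∀ f g → dim f ≤ ℓ → dim g ≤ ℓ → φ f ≼ φ g → f ≼ g
    φ-down  : ∀ f (h : Face n) → dim f ≤ ℓ → h ≼ φ f →
              ∃ λ g → dim g ≤ ℓ × φ g ≡ h

_∈ᶜ_ : ∀ {ℓ n} → Face n → Copy ℓ n → Set
_∈ᶜ_ {ℓ} h K = ∃ λ g → dim g ≤ ℓ × Copy.φ K g ≡ h

Decomposes : ℕ → ℕ → Set
Decomposes ℓ n =
  Σ ℕ λ r → Σ (Fin r → Copy ℓ n) λ L →
    (∀ (h : Face n) → dim h ≤ ℓ → Σ (Fin r) λ j → h ∈ᶜ L j)
    × (∀ (h : Face n) → dim h ≡ ℓ → ExactlyOne (λ j → h ∈ᶜ L j))

{-# OPTIONS --safe #-}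
-- Given a Steiner system S(ℓ, ℓ+1, n) on the coordinates of Q_n, take as copies the boundaries
-- of all (ℓ+1)-faces of Q_n whose set of free coordinates is a block. An ℓ-face h lies on the
-- boundary of an (ℓ+1)-face f iff f arises from h by freeing one more coordinate, and f is then
-- determined by its set of free coordinates; as the free set of h lies in exactly one block, h
-- lies in exactly one copy. Every face of dimension below ℓ lies below some ℓ-face since ℓ < n.
-- The hypothesis n ∉ 𝒳 gives a configuration only up to double negation; but configurations on
-- a finite set can be searched exhaustively, so their existence is decidable and hence stable.
module Submission where

open import Defs
open import Data.Nat using (ℕ; suc; _≤_)
open import Relation.Nullary using (¬_)

open import Data.Nat using (zero; z≤n; s≤s)
open import Data.Nat.Properties using (≤-refl; ≤-trans; ≤-antisym; m≤n⇒m≤1+n; n≤1+n; ≰⇒>; _≤?_; suc-injective)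
import Data.Nat.Properties as ℕ
open import Data.Bool using (Bool; true; false; T; _≟_)
open import Data.Bool.Properties using (T?)
open import Data.Fin using (Fin)
import Data.Fin as Fin
open import Data.Fin.Properties using (any?)
open import Data.Fin.Subset using (Subset; _⊆_; ∣_∣)
open import Data.Fin.Subset.Properties using (_⊆?_; anySubset?; out⊆; s⊆s; drop-∷-⊆)
open import Data.Vec using ([]; _∷_; replicate; here)
open import Data.Vec.Properties using (∷-injectiveˡ; ∷-injectiveʳ; ∷-injective; ≡-dec)
open import Data.List using (List; length; filter; cartesianProductWith; lookup)
import Data.List as List
open import Data.List.Membership.Propositional using (_∈_)
open import Data.List.Membership.Propositional.Properties using (∈-cartesianProductWith⁺; ∈-filter⁺; ∈-filter⁻; ∈-lookup)
open import Data.List.Relation.Unary.Any using (here; there; index)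
open import Data.List.Relation.Unary.Any.Properties using (lookup-index)
import Data.List.Relation.Unary.All as All
open import Data.List.Relation.Unary.AllPairs using (_∷_)
import Data.List.Relation.Unary.AllPairs as AllPairs
open import Data.List.Relation.Unary.Unique.Propositional using (Unique)
import Data.List.Relation.Unary.Unique.Propositional.Properties as Unique
open import Data.Product using (∃; _×_; _,_; proj₁; proj₂)
open import Data.Empty using (⊥-elim)
open import Function using (_∘_)
open import Relation.Nullary using (Dec; yes; no)
open import Relation.Nullary.Decidable using (_×-dec_; _→-dec_; toWitness; fromWitness; decidable-stable)
import Relation.Nullary.Decidable as Dec
open import Relation.Binary.PropositionalEquality using (_≡_; refl; sym; trans; cong; cong₂; subst)

allSubsets? : ∀ {n} {P : Subset n → Set} → (∀ s → Dec (P s)) → Dec (∀ s → P s)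
allSubsets? P? with anySubset? (λ s → Dec.¬? (P? s))
... | yes (s , ¬p) = no λ all → ¬p (all s)
... | no ∄¬p = yes λ s → decidable-stable (P? s) λ ¬p → ∄¬p (s , ¬p)

-- A family of subsets of Fin n, stored as a complete binary tree of depth n so that
-- the families themselves can be enumerated.
Family : ℕ → Set
Family zero = Bool
Family (suc n) = Family n × Family n

member : ∀ {n} → Family n → Subset n → Bool
member {zero} b [] = b
member {suc n} (c₁ , c₀) (true ∷ s) = member c₁ s
member {suc n} (c₁ , c₀) (false ∷ s) = member c₀ s

family : ∀ {n} → (Subset n → Bool) → Family n
family {zero} B = B []
family {suc n} B = family (B ∘ (true ∷_)) , family (B ∘ (false ∷_))

member-family : ∀ {n} (B : Subset n → Bool) s → member (family B) s ≡ B s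
member-family {zero} B [] = refl
member-family {suc n} B (true ∷ s) = member-family (B ∘ (true ∷_)) s
member-family {suc n} B (false ∷ s) = member-family (B ∘ (false ∷_)) s

anyFamily? : ∀ {n} {P : Family n → Set} → (∀ c → Dec (P c)) → Dec (∃ P)
anyFamily? {zero} P? with P? true | P? false
... | yes p | _ = yes (true , p)
... | no _ | yes q = yes (false , q)
... | no ¬p | no ¬q = no λ { (true , p) → ¬p p ; (false , q) → ¬q q }
anyFamily? {suc n} P? with anyFamily? (λ c → anyFamily? (λ c' → P? (c , c')))
... | yes (c , c' , p) = yes ((c , c') , p)
... | no ∄p = no λ { ((c , c') , p) → ∄p (c , c' , p) }

module _ {n : ℕ} (B : Subset n → Bool) where

  LiesInUniqueBlock : Subset n → Set
  LiesInUniqueBlock t = (∃ λ s → T (B s) × t ⊆ s)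
                      × (∀ s s' → T (B s) → T (B s') → t ⊆ s → t ⊆ s' → s ≡ s')

  IsSteiner : ℕ → Set
  IsSteiner ℓ = (∀ s → T (B s) → ∣ s ∣ ≡ suc ℓ) × (∀ t → ∣ t ∣ ≡ ℓ → LiesInUniqueBlock t)

  isSteiner? : ∀ ℓ → Dec (IsSteiner ℓ)
  isSteiner? ℓ =
    allSubsets? (λ s → T? (B s) →-dec (∣ s ∣ ℕ.≟ suc ℓ)) ×-dec
    allSubsets? (λ t → (∣ t ∣ ℕ.≟ ℓ) →-dec
      (anySubset? (λ s → T? (B s) ×-dec (t ⊆? s)) ×-dec
       allSubsets? (λ s → allSubsets? (λ s' →
         T? (B s) →-dec T? (B s') →-dec (t ⊆? s) →-dec (t ⊆? s') →-dec ≡-dec _≟_ s s'))))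

configuration⇒steiner : ∀ {ℓ n} → Configuration n (suc ℓ) ℓ → ∃ λ (c : Family n) → IsSteiner (member c) ℓ
configuration⇒steiner {ℓ} {n} conf = family isBlock , blocks-have-size , lies-in-unique-block
  where
  open Configuration conf
  block? : ∀ s → Dec (∃ λ j → block j ≡ s)
  block? s = any? (λ j → ≡-dec _≟_ (block j) s)

  isBlock : Subset n → Bool
  isBlock s = Dec.isYes (block? s)

  block-of : ∀ s → T (member (family isBlock) s) → ∃ λ j → block j ≡ s
  block-of s b = toWitness {a? = block? s} (subst T (member-family isBlock s) b)

  is-block : ∀ j → T (member (family isBlock) (block j))
  is-block j = subst T (sym (member-family isBlock (block j))) (fromWitness (j , refl))

  blocks-have-size : ∀ s → T (member (family isBlock) s) → ∣ s ∣ ≡ suc ℓ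
  blocks-have-size s b with block-of s b
  ... | j , refl = blockSize j

  lies-in-unique-block : ∀ t → ∣ t ∣ ≡ ℓ → LiesInUniqueBlock (member (family isBlock)) t
  lies-in-unique-block t ∣t∣≡ℓ with cover t ∣t∣≡ℓ
  ... | j , t⊆j , unique = (block j , is-block j , t⊆j) , same-block
    where
    same-block : ∀ s s' → T (member (family isBlock) s) → T (member (family isBlock) s') → t ⊆ s → t ⊆ s' → s ≡ s'
    same-block s s' b b' t⊆s t⊆s' with block-of s b | block-of s' b'
    ... | k , refl | k' , refl = cong block (trans (unique k t⊆s) (sym (unique k' t⊆s')))

steinerFamily? : ∀ ℓ n → Dec (∃ λ (c : Family n) → IsSteiner (member c) ℓ)
steinerFamily? ℓ n = anyFamily? (λ c → isSteiner? (member c) ℓ)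

isFree : Sym → Bool
isFree ⋆ = true
isFree o = false
isFree i = false

free : ∀ {n} → Face n → Subset n
free [] = []
free (a ∷ f) = isFree a ∷ free f

∣free∣≡dim : ∀ {n} (f : Face n) → ∣ free f ∣ ≡ dim f
∣free∣≡dim [] = refl
∣free∣≡dim (o ∷ f) = ∣free∣≡dim f
∣free∣≡dim (i ∷ f) = ∣free∣≡dim f
∣free∣≡dim (⋆ ∷ f) = cong suc (∣free∣≡dim f)

top : ∀ m → Face m
top m = replicate m ⋆

dim-top : ∀ m → dim (top m) ≡ m
dim-top zero = refl
dim-top (suc m) = cong suc (dim-top m)

≼-top : ∀ {m} (f : Face m) → f ≼ top m
≼-top [] = []
≼-top (a ∷ f) = star ∷ ≼-top f

≼s-trans : ∀ {a b c} → a ≼s b → b ≼s c → a ≼s c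
≼s-trans same q = q
≼s-trans star same = star
≼s-trans star star = star

≼-trans : ∀ {n} {f g h : Face n} → f ≼ g → g ≼ h → f ≼ h
≼-trans [] [] = []
≼-trans (p ∷ ps) (q ∷ qs) = ≼s-trans p q ∷ ≼-trans ps qs

dim-mono : ∀ {n} {f g : Face n} → f ≼ g → dim f ≤ dim g
dim-mono [] = z≤n
dim-mono (same {o} ∷ ps) = dim-mono ps
dim-mono (same {i} ∷ ps) = dim-mono ps
dim-mono (same {⋆} ∷ ps) = s≤s (dim-mono ps)
dim-mono (star {o} ∷ ps) = m≤n⇒m≤1+n (dim-mono ps)
dim-mono (star {i} ∷ ps) = m≤n⇒m≤1+n (dim-mono ps)
dim-mono (star {⋆} ∷ ps) = s≤s (dim-mono ps)

free-mono : ∀ {n} {f g : Face n} → f ≼ g → free f ⊆ free g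
free-mono [] ()
free-mono (same ∷ ps) = s⊆s (free-mono ps)
free-mono (star {o} ∷ ps) = out⊆ (free-mono ps)
free-mono (star {i} ∷ ps) = out⊆ (free-mono ps)
free-mono (star {⋆} ∷ ps) = s⊆s (free-mono ps)

≼s-free-injective : ∀ {a b b'} → a ≼s b → a ≼s b' → isFree b ≡ isFree b' → b ≡ b'
≼s-free-injective same same _ = refl
≼s-free-injective (same {⋆}) star _ = refl
≼s-free-injective star (same {⋆}) _ = refl
≼s-free-injective star star _ = refl
≼s-free-injective (same {o}) star ()
≼s-free-injective (same {i}) star ()
≼s-free-injective star (same {o}) ()
≼s-free-injective star (same {i}) ()

≼-free-injective : ∀ {n} {h f g : Face n} → h ≼ f → h ≼ g → free f ≡ free g → f ≡ g
≼-free-injective [] [] _ = refl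
≼-free-injective (p ∷ ps) (q ∷ qs) eq =
  cong₂ _∷_ (≼s-free-injective p q (∷-injectiveˡ eq)) (≼-free-injective ps qs (∷-injectiveʳ eq))

release : ∀ {n} → Face n → Subset n → Face n
release [] [] = []
release (a ∷ f) (true ∷ s) = ⋆ ∷ release f s
release (a ∷ f) (false ∷ s) = a ∷ release f s

≼-release : ∀ {n} (f : Face n) s → free f ⊆ s → f ≼ release f s
≼-release [] [] _ = []
≼-release (a ∷ f) (true ∷ s) f⊆s = star ∷ ≼-release f s (drop-∷-⊆ f⊆s)
≼-release (o ∷ f) (false ∷ s) f⊆s = same ∷ ≼-release f s (drop-∷-⊆ f⊆s)
≼-release (i ∷ f) (false ∷ s) f⊆s = same ∷ ≼-release f s (drop-∷-⊆ f⊆s)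
≼-release (⋆ ∷ f) (false ∷ s) f⊆s with () ← f⊆s here

free-release : ∀ {n} (f : Face n) s → free f ⊆ s → free (release f s) ≡ s
free-release [] [] _ = refl
free-release (a ∷ f) (true ∷ s) f⊆s = cong (true ∷_) (free-release f s (drop-∷-⊆ f⊆s))
free-release (o ∷ f) (false ∷ s) f⊆s = cong (false ∷_) (free-release f s (drop-∷-⊆ f⊆s))
free-release (i ∷ f) (false ∷ s) f⊆s = cong (false ∷_) (free-release f s (drop-∷-⊆ f⊆s))
free-release (⋆ ∷ f) (false ∷ s) f⊆s with () ← f⊆s here

≼-face-of-dim : ∀ {n} (h : Face n) k → dim h ≤ k → k ≤ n → ∃ λ f → h ≼ f × dim f ≡ k
≼-face-of-dim [] zero z≤n z≤n = [] , [] , refl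
≼-face-of-dim (⋆ ∷ h) (suc k) (s≤s h≤k) (s≤s k≤n) with ≼-face-of-dim h k h≤k k≤n
... | f , h≼f , refl = ⋆ ∷ f , same ∷ h≼f , refl
≼-face-of-dim {suc n} (o ∷ h) k h≤k k≤1+n with k ≤? n
... | yes k≤n = let f , h≼f , eq = ≼-face-of-dim h k h≤k k≤n in o ∷ f , same ∷ h≼f , eq
... | no k≰n = top (suc n) , ≼-top (o ∷ h) , trans (dim-top (suc n)) (≤-antisym (≰⇒> k≰n) k≤1+n)
≼-face-of-dim {suc n} (i ∷ h) k h≤k k≤1+n with k ≤? n
... | yes k≤n = let f , h≼f , eq = ≼-face-of-dim h k h≤k k≤n in i ∷ f , same ∷ h≼f , eq
... | no k≰n = top (suc n) , ≼-top (i ∷ h) , trans (dim-top (suc n)) (≤-antisym (≰⇒> k≰n) k≤1+n)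

-- embed f g : the face of f whose free coordinates are filled in, in order, by g.
-- When dim f ≡ m this identifies the face poset of Q_m with the faces of f.
embed : ∀ {n m} → Face n → Face m → Face n
embed [] g = []
embed (⋆ ∷ f) [] = ⋆ ∷ embed f []
embed (⋆ ∷ f) (a ∷ g) = a ∷ embed f g
embed (o ∷ f) g = o ∷ embed f g
embed (i ∷ f) g = i ∷ embed f g

dim-embed : ∀ {n m} → (f : Face n) (g : Face m) → dim f ≡ m → dim (embed f g) ≡ dim g
dim-embed [] [] _ = refl
dim-embed (⋆ ∷ f) (o ∷ g) eq = dim-embed f g (suc-injective eq)
dim-embed (⋆ ∷ f) (i ∷ g) eq = dim-embed f g (suc-injective eq)
dim-embed (⋆ ∷ f) (⋆ ∷ g) eq = cong suc (dim-embed f g (suc-injective eq))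
dim-embed (o ∷ f) g eq = dim-embed f g eq
dim-embed (i ∷ f) g eq = dim-embed f g eq

embed-injective : ∀ {n m} → (f : Face n) {g g' : Face m} → dim f ≡ m → embed f g ≡ embed f g' → g ≡ g'
embed-injective [] {[]} {[]} _ _ = refl
embed-injective (⋆ ∷ f) {a ∷ g} {b ∷ g'} eq p =
  cong₂ _∷_ (∷-injectiveˡ p) (embed-injective f (suc-injective eq) (∷-injectiveʳ p))
embed-injective (o ∷ f) eq p = embed-injective f eq (∷-injectiveʳ p)
embed-injective (i ∷ f) eq p = embed-injective f eq (∷-injectiveʳ p)

embed-mono : ∀ {n m} → (f : Face n) {g g' : Face m} → g ≼ g' → embed f g ≼ embed f g'
embed-mono [] _ = []
embed-mono (⋆ ∷ f) [] = same ∷ embed-mono f []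
embed-mono (⋆ ∷ f) (p ∷ ps) = p ∷ embed-mono f ps
embed-mono (o ∷ f) p = same ∷ embed-mono f p
embed-mono (i ∷ f) p = same ∷ embed-mono f p

embed-reflects-≼ : ∀ {n m} → (f : Face n) {g g' : Face m} → dim f ≡ m → embed f g ≼ embed f g' → g ≼ g'
embed-reflects-≼ [] {[]} {[]} _ _ = []
embed-reflects-≼ (⋆ ∷ f) {a ∷ g} {b ∷ g'} eq (p ∷ ps) = p ∷ embed-reflects-≼ f (suc-injective eq) ps
embed-reflects-≼ (o ∷ f) eq (_ ∷ ps) = embed-reflects-≼ f eq ps
embed-reflects-≼ (i ∷ f) eq (_ ∷ ps) = embed-reflects-≼ f eq ps

≼-embed : ∀ {n m} → (f : Face n) (g : Face m) {h : Face n} → dim f ≡ m → h ≼ embed f g →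
          ∃ λ g' → g' ≼ g × embed f g' ≡ h
≼-embed [] [] _ [] = [] , [] , refl
≼-embed (⋆ ∷ f) (b ∷ g) {a ∷ h} eq (p ∷ ps) with ≼-embed f g (suc-injective eq) ps
... | g' , g'≼g , refl = a ∷ g' , p ∷ g'≼g , refl
≼-embed (o ∷ f) g eq (same ∷ ps) with ≼-embed f g eq ps
... | g' , g'≼g , refl = g' , g'≼g , refl
≼-embed (i ∷ f) g eq (same ∷ ps) with ≼-embed f g eq ps
... | g' , g'≼g , refl = g' , g'≼g , refl

embed-top : ∀ {n m} (f : Face n) → dim f ≡ m → embed f (top m) ≡ f
embed-top [] _ = refl
embed-top {m = suc m} (⋆ ∷ f) eq = cong (⋆ ∷_) (embed-top f (suc-injective eq))
embed-top (o ∷ f) eq = cong (o ∷_) (embed-top f eq)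
embed-top (i ∷ f) eq = cong (i ∷_) (embed-top f eq)

boundaryCopy : ∀ {ℓ n} (f : Face n) → dim f ≡ suc ℓ → Copy ℓ n
boundaryCopy {ℓ} f eq = record
  { φ      = embed f
  ; φ-skel = λ g g≤ℓ → subst (_≤ ℓ) (sym (dim-embed f g eq)) g≤ℓ
  ; φ-inj  = λ _ _ _ _ → embed-injective f eq
  ; φ-mono = λ _ _ _ _ → embed-mono f
  ; φ-refl = λ _ _ _ _ → embed-reflects-≼ f eq
  ; φ-down = λ g _ g≤ℓ h≼ → let g' , g'≼g , p = ≼-embed f g eq h≼ in g' , ≤-trans (dim-mono g'≼g) g≤ℓ , p
  }

∈boundaryCopy⇒≼ : ∀ {ℓ n} (f : Face n) (eq : dim f ≡ suc ℓ) {h} → h ∈ᶜ boundaryCopy f eq → h ≼ f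
∈boundaryCopy⇒≼ f eq (g , _ , refl) = subst (embed f g ≼_) (embed-top f eq) (embed-mono f (≼-top g))

≼⇒∈boundaryCopy : ∀ {ℓ n} (f : Face n) (eq : dim f ≡ suc ℓ) {h} → h ≼ f → dim h ≤ ℓ → h ∈ᶜ boundaryCopy f eq
≼⇒∈boundaryCopy {ℓ} f eq {h} h≼f h≤ℓ
  with ≼-embed f (top (suc ℓ)) eq (subst (h ≼_) (sym (embed-top f eq)) h≼f)
... | g , _ , refl = g , subst (_≤ ℓ) (dim-embed f g eq) h≤ℓ , refl

symbols : List Sym
symbols = o List.∷ i List.∷ ⋆ List.∷ List.[]

∈-symbols : ∀ a → a ∈ symbols
∈-symbols o = here refl
∈-symbols i = there (here refl)
∈-symbols ⋆ = there (there (here refl))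

symbols-unique : Unique symbols
symbols-unique = ((λ ()) All.∷ (λ ()) All.∷ All.[]) ∷ ((λ ()) All.∷ All.[]) ∷ All.[] ∷ AllPairs.[]

allFaces : ∀ n → List (Face n)
allFaces zero = [] List.∷ List.[]
allFaces (suc n) = cartesianProductWith _∷_ symbols (allFaces n)

∈-allFaces : ∀ {n} (f : Face n) → f ∈ allFaces n
∈-allFaces [] = here refl
∈-allFaces (a ∷ f) = ∈-cartesianProductWith⁺ _∷_ (∈-symbols a) (∈-allFaces f)

allFaces-unique : ∀ n → Unique (allFaces n)
allFaces-unique zero = All.[] ∷ AllPairs.[]
allFaces-unique (suc n) = Unique.cartesianProductWith⁺ _∷_ ∷-injective symbols-unique (allFaces-unique n)

lookup-injective : ∀ {A : Set} {xs : List A} → Unique xs → ∀ j k → lookup xs j ≡ lookup xs k → j ≡ k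
lookup-injective (_ ∷ _) Fin.zero Fin.zero _ = refl
lookup-injective (x∉ ∷ _) Fin.zero (Fin.suc k) eq = ⊥-elim (All.lookup x∉ (∈-lookup k) eq)
lookup-injective (x∉ ∷ _) (Fin.suc j) Fin.zero eq = ⊥-elim (All.lookup x∉ (∈-lookup j) (sym eq))
lookup-injective (_ ∷ xs-unique) (Fin.suc j) (Fin.suc k) eq = cong Fin.suc (lookup-injective xs-unique j k eq)

module SteinerDecomposition {ℓ n : ℕ} (ℓ<n : suc ℓ ≤ n) (B : Subset n → Bool) (steiner : IsSteiner B ℓ) where

  Chosen : Face n → Set
  Chosen f = T (B (free f))

  chosenFaces : List (Face n)
  chosenFaces = filter (λ f → T? (B (free f))) (allFaces n)

  chosenFace : Fin (length chosenFaces) → Face n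
  chosenFace = lookup chosenFaces

  chosenFace-chosen : ∀ j → Chosen (chosenFace j)
  chosenFace-chosen j = proj₂ (∈-filter⁻ (λ f → T? (B (free f))) {xs = allFaces n} (∈-lookup j))

  chosenFace-surjective : ∀ {f} → Chosen f → ∃ λ j → chosenFace j ≡ f
  chosenFace-surjective {f} chosen = index f∈ , sym (lookup-index f∈)
    where f∈ = ∈-filter⁺ (λ f → T? (B (free f))) (∈-allFaces f) chosen

  dim-chosen : ∀ {f} → Chosen f → dim f ≡ suc ℓ
  dim-chosen {f} chosen = trans (sym (∣free∣≡dim f)) (proj₁ steiner (free f) chosen)

  copy : Fin (length chosenFaces) → Copy ℓ n
  copy j = boundaryCopy (chosenFace j) (dim-chosen (chosenFace-chosen j))

  ≼-chosen : ∀ h → dim h ≤ ℓ → ∃ λ f → Chosen f × h ≼ f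
  ≼-chosen h h≤ℓ with ≼-face-of-dim h ℓ h≤ℓ (≤-trans (n≤1+n ℓ) ℓ<n)
  ... | h' , h≼h' , refl with proj₁ (proj₂ steiner (free h') (∣free∣≡dim h'))
  ... | s , block , h'⊆s =
    release h' s , subst (T ∘ B) (sym (free-release h' s h'⊆s)) block , ≼-trans h≼h' (≼-release h' s h'⊆s)

  chosen-unique : ∀ h → dim h ≡ ℓ → ∀ {f g} → Chosen f → Chosen g → h ≼ f → h ≼ g → f ≡ g
  chosen-unique h refl {f} {g} chosen-f chosen-g h≼f h≼g = ≼-free-injective h≼f h≼g
    (proj₂ (proj₂ steiner (free h) (∣free∣≡dim h)) (free f) (free g) chosen-f chosen-g (free-mono h≼f) (free-mono h≼g))

  covers : ∀ h → dim h ≤ ℓ → ∃ λ j → h ∈ᶜ copy j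
  covers h h≤ℓ with ≼-chosen h h≤ℓ
  ... | f , chosen , h≼f with chosenFace-surjective chosen
  ... | j , refl = j , ≼⇒∈boundaryCopy f (dim-chosen (chosenFace-chosen j)) h≼f h≤ℓ

  in-unique-copy : ∀ h → dim h ≡ ℓ → ExactlyOne (λ j → h ∈ᶜ copy j)
  in-unique-copy h refl with covers h ≤-refl
  ... | j , h∈j = j , h∈j , λ k h∈k → lookup-injective (Unique.filter⁺ (λ f → T? (B (free f))) (allFaces-unique n)) k j
    (chosen-unique h refl (chosenFace-chosen k) (chosenFace-chosen j) (below k h∈k) (below j h∈j))
    where
    below : ∀ j → h ∈ᶜ copy j → h ≼ chosenFace j
    below j = ∈boundaryCopy⇒≼ (chosenFace j) (dim-chosen (chosenFace-chosen j))

  decomposes : Decomposes ℓ n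
  decomposes = length chosenFaces , copy , covers , in-unique-copy

theorem3 : (ℓ n : ℕ) → 1 ≤ ℓ →
    InD (suc ℓ) ℓ n → ¬ InX (suc ℓ) ℓ n → Decomposes ℓ n
theorem3 ℓ n _ inD@(ℓ<n , _) n∉𝒳
  with c , steiner ← decidable-stable (steinerFamily? ℓ n) (λ none → n∉𝒳 (inD , none ∘ configuration⇒steiner))
  = SteinerDecomposition.decomposes ℓ<n (member c) steiner
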